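{- For every integer $k\geq1$, the maximum outerthickness of a graph of treewidth at most $k$ is $k$.
   Context: Graphs are finite and simple. A $k$-tree is defined recursively: $K_{k+1}$ is a $k$-tree, and if $G$ has a vertex $v$ whose neighbourhood is a $k$-clique and $G-v$ is a $k$-tree then $G$ is a $k$-tree. The treewidth of $G$ is the minimum $k$ such that $G$ is a spanning subgraph of a $k$-tree. The outerthickness of $G$ is the minimum number of outerplanar subgraphs whose edge sets partition $E(G)$. -}

module Defs where

open import Data.Nat using (ℕ; zero; suc; _≤_)
open import Data.Fin using (Fin; toℕ; punchIn)
open import Data.Bool using (Bool; true; false)
open import Data.Product using (Σ; _×_; ∃; ∃-syntax; _,_)
open import Relation.Binary.PropositionalEquality using (_≡_; _≢_)
open import Relation.Nullary using (¬_)
open import Function.Definitions using (Injective)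
import Data.Nat as N

record Graph (n : ℕ) : Set where
  field
    adj    : Fin n → Fin n → Bool
    sym    : ∀ u v → adj u v ≡ adj v u
    irrefl : ∀ u → adj u u ≡ false
open Graph public

Adj : ∀ {n} → Graph n → Fin n → Fin n → Set
Adj G u v = adj G u v ≡ true

deleteVertex : ∀ {n} → Graph (suc n) → Fin (suc n) → Graph n
deleteVertex G v = record
  { adj    = λ a b → adj G (punchIn v a) (punchIn v b)
  ; sym    = λ a b → sym G (punchIn v a) (punchIn v b)
  ; irrefl = λ a → irrefl G (punchIn v a)
  }

Complete : ∀ {n} → Graph n → Set
Complete {n} G = ∀ (u v : Fin n) → u ≢ v → Adj G u v

-- k-trees, defined recursively as in the paper:
--  * K_{k+1} is a k-tree;
--  * if G has a vertex v whose neighbourhood is a k-clique and G - v is a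
--    k-tree, then G is a k-tree.
-- "the neighbourhood of v is a k-clique" : there is an injective
-- f : Fin k → Fin n (vertices of G - v) whose image is exactly the set of
-- neighbours of v, and whose image is pairwise adjacent.
data KTree (k : ℕ) : (n : ℕ) → Graph n → Set where
  base : (G : Graph (suc k)) → Complete G → KTree k (suc k) G
  step : ∀ {n} (G : Graph (suc n)) (v : Fin (suc n))
       → (f : Fin k → Fin n)
       → Injective _≡_ _≡_ f
       → (∀ a → Adj G v (punchIn v a) → ∃[ i ] f i ≡ a)
       → (∀ i → Adj G v (punchIn v (f i)))
       → (∀ i j → i ≢ j → Adj G (punchIn v (f i)) (punchIn v (f j)))
       → KTree k n (deleteVertex G v)
       → KTree k (suc n) G

SpanningSubgraph : ∀ {n} → Graph n → Graph n → Set
SpanningSubgraph {n} G H = ∀ (u v : Fin n) → Adj G u v → Adj H u v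

SubgraphOfKTree : ℕ → ∀ {n} → Graph n → Set
SubgraphOfKTree j {n} G = Σ (Graph n) λ H → KTree j n H × SpanningSubgraph G H

-- treewidth(G) ≤ k  (treewidth = least j with G a spanning subgraph of a j-tree)
TreewidthAtMost : ℕ → ∀ {n} → Graph n → Set
TreewidthAtMost k G = Σ ℕ λ j → j ≤ k × SubgraphOfKTree j G

-- Outerplanarity of an edge relation E on Fin n: the vertices can be placed
-- in convex position on a circle (cyclic order given by an injective
-- position map) so that all edges drawn as chords are pairwise non-crossing,
-- i.e. no two edges ab, cd have interleaved endpoints pos a < pos c < pos b < pos d.
OuterplanarRel : ∀ {n} → (Fin n → Fin n → Set) → Set
OuterplanarRel {n} E =
  Σ (Fin n → ℕ) λ pos →
    Injective _≡_ _≡_ pos ×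
    (∀ a b c d → E a b → E c d →
       ¬ (pos a N.< pos c × pos c N.< pos b × pos b N.< pos d))

Outerplanar : ∀ {n} → Graph n → Set
Outerplanar G = OuterplanarRel (Adj G)

-- outerthickness(G) ≤ k : E(G) can be partitioned into k outerplanar
-- subgraphs, given as a (symmetric) colouring of the edges with k colours
-- such that each colour class is outerplanar.
OuterthicknessAtMost : ℕ → ∀ {n} → Graph n → Set
OuterthicknessAtMost k {n} G =
  Σ (Fin n → Fin n → Fin k) λ col →
    (∀ u v → Adj G u v → col u v ≡ col v u) ×
    (∀ (i : Fin k) → OuterplanarRel (λ u v → Adj G u v × col u v ≡ i))

{-# OPTIONS --safe #-}
-- Upper bound: a graph of treewidth at most k is a spanning subgraph of a k-tree, hence
-- k-degenerate.  Remove a vertex v with at most k remaining neighbours, colour the rest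
-- inductively, and give the edges at v pairwise distinct colours.  Then v is a pendant vertex
-- of every colour class, and drawing it on the circle right next to its unique neighbour keeps
-- the class outerplanar.
-- Lower bound: the complete split graph K_k + (complement of K_m) is a k-tree.  With k - 1
-- colours, every independent vertex sends two edges of one colour γ to clique vertices i < j;
-- for m = 2 k² (k - 1) + 1 three independent vertices share the same (i, j, γ), which gives a
-- K₂,₃ in colour γ, and K₂,₃ is not outerplanar.
module Submission where

open import Defs
open import Data.Nat using (ℕ; _≤_; _∸_)
open import Data.Product using (Σ; _×_)
open import Relation.Nullary using (¬_)

open import Data.Nat using (zero; suc; _+_; _*_; _<_; s≤s; z<s; s≤s⁻¹; _<?_)
open import Data.Nat.Properties
  using (m≤n⇒m≤1+n; <⇒≱; <-asym; <-trans; n<1+n; *-cancelˡ-<; *-cancelˡ-≡; even≢odd;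
         m≤n⇒m<n∨m≡n; ≮⇒≥; <⇒≤; <-cmp; m≤m+n; ≤-antisym; ≤-refl; m<m+n)
open import Data.Fin as F using (Fin; toℕ; _↑ˡ_; _↑ʳ_; fromℕ; fromℕ<; punchIn; punchOut; inject≤)
open import Data.Fin.Properties
  using (any?; inject≤-injective; punchIn-punchOut; punchIn-injective; punchInᵢ≢i;
         toℕ-injective; toℕ<n; toℕ-fromℕ; toℕ-fromℕ<; toℕ-inject≤; pigeonhole; combine-injective;
         toℕ-↑ˡ; toℕ-↑ʳ; ↑ˡ-injective; ↑ʳ-injective)
  renaming (<⇒≢ to Fin<⇒≢; <-trans to Fin<-trans)
open import Data.Fin.Patterns using (0F; 1F)
open import Data.Product using (∃₂; ∃-syntax; _,_; proj₁; proj₂)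
import Data.Product
open import Data.Bool using (true)
open import Data.Empty using (⊥)
open import Data.Sum using (_⊎_; inj₁; inj₂)
import Data.Sum
open import Data.Vec.Functional using (insertAt)
open import Data.Vec.Functional.Properties using (insertAt-lookup; insertAt-punchIn)
open import Function.Base using (id; _∘_)
open import Function.Bundles using (_⇔_; mk⇔; Equivalence)
open import Function.Definitions using (Injective)
open import Relation.Binary.Definitions using (Decidable; Symmetric; tri<; tri≈; tri>)
open import Relation.Binary.PropositionalEquality as ≡ using (_≡_; _≢_; refl; trans; cong; subst)
open import Relation.Nullary using (Dec; yes; no; does; contradiction)
open import Relation.Nullary.Decidable using (_×-dec_; _⊎-dec_; ¬?; dec-true; dec-false; does-⇔)

Adj-sym : ∀ {n} (G : Graph n) {u w} → Adj G u w → Adj G w u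
Adj-sym G {u} {w} e = trans (sym G w u) e

Adj-irrefl : ∀ {n} (G : Graph n) u → ¬ Adj G u u
Adj-irrefl G u e with trans (≡.sym e) (irrefl G u)
... | ()

data PunchView {n} (v : Fin (suc n)) : Fin (suc n) → Set where
  at      : PunchView v v
  punched : (a : Fin n) → PunchView v (punchIn v a)

punchView : ∀ {n} (v u : Fin (suc n)) → PunchView v u
punchView v u with v F.≟ u
... | yes refl = at
... | no v≢u   = subst (PunchView v) (punchIn-punchOut v≢u) (punched (punchOut v≢u))

record Three {n} (P : Fin n → Set) : Set where
  field
    x y z : Fin n
    x≢y : x ≢ y
    x≢z : x ≢ z
    y≢z : y ≢ z
    Px : P x
    Py : P y
    Pz : P z

Three-map : ∀ {m n} {P : Fin m → Set} {Q : Fin n → Set} {g : Fin m → Fin n} →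
            Injective _≡_ _≡_ g → (∀ {t} → P t → Q (g t)) → Three P → Three Q
Three-map {g = g} g-injective P⇒Q T = record
  { x = g x ; y = g y ; z = g z
  ; x≢y = x≢y ∘ g-injective ; x≢z = x≢z ∘ g-injective ; y≢z = y≢z ∘ g-injective
  ; Px = P⇒Q Px ; Py = P⇒Q Py ; Pz = P⇒Q Pz
  }
  where open Three T

-- Outerplanar drawings

ColourClass : ∀ {k n} → Graph n → (Fin n → Fin n → Fin k) → Fin k → Fin n → Fin n → Set
ColourClass G col c u w = Adj G u w × col u w ≡ c

NonCrossing : ∀ {n} → (Fin n → Fin n → Set) → (Fin n → ℕ) → Set
NonCrossing E pos =
  ∀ a b c d → E a b → E c d → ¬ (pos a < pos c × pos c < pos b × pos b < pos d)

NonCrossing-mono : ∀ {n} {E E′ : Fin n → Fin n → Set} {pos : Fin n → ℕ} →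
                   (∀ u w → E u w → E′ u w) → NonCrossing E′ pos → NonCrossing E pos
NonCrossing-mono E⊆E′ nc a b c d eab ecd = nc a b c d (E⊆E′ a b eab) (E⊆E′ c d ecd)

OuterplanarRel-mono : ∀ {n} {E E′ : Fin n → Fin n → Set} →
                      (∀ u w → E u w → E′ u w) → OuterplanarRel E′ → OuterplanarRel E
OuterplanarRel-mono E⊆E′ (pos , pos-injective , nc) =
  pos , pos-injective , NonCrossing-mono E⊆E′ nc

OuterthicknessAtMost-spanningSubgraph : ∀ {k n} {G H : Graph n} →
  SpanningSubgraph G H → OuterthicknessAtMost k H → OuterthicknessAtMost k G
OuterthicknessAtMost-spanningSubgraph G⊆H (col , col-sym , outerplanar) =
  col , (λ u w e → col-sym u w (G⊆H u w e)) ,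
  λ c → OuterplanarRel-mono (λ u w (e , eq) → G⊆H u w e , eq) (outerplanar c)

nothing-strictly-between-successors : ∀ {x y z} → x < y → y < z → ¬ (z ≡ suc x ⊎ x ≡ suc z)
nothing-strictly-between-successors x<y y<z (inj₁ refl) = <⇒≱ y<z x<y
nothing-strictly-between-successors x<y y<z (inj₂ refl) = <-asym (<-trans x<y y<z) (n<1+n _)

halve-< : ∀ {x y m n} → x ≡ 2 * m → y ≡ 2 * n → x < y → m < n
halve-< refl refl = *-cancelˡ-< 2 _ _

-- If every neighbour of v sits at position p, draw v at 2p + 1 and every other vertex a at
-- 2 pos a: the chords at v then join consecutive positions, so they cross nothing.
module InsertPendant {n} {E : Fin (suc n) → Fin (suc n) → Set} (v : Fin (suc n))
  (pos : Fin n → ℕ) (pos-injective : Injective _≡_ _≡_ pos)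
  (noncrossing : NonCrossing (λ a b → E (punchIn v a) (punchIn v b)) pos)
  (E-irrefl-v : ¬ E v v) (p : ℕ)
  (neighbours-at-p : ∀ a → E v (punchIn v a) ⊎ E (punchIn v a) v → pos a ≡ p) where

  pos′ : Fin (suc n) → ℕ
  pos′ = insertAt (λ a → 2 * pos a) v (suc (2 * p))

  pos′-v : pos′ v ≡ suc (2 * p)
  pos′-v = insertAt-lookup _ v _

  pos′-punchIn : ∀ a → pos′ (punchIn v a) ≡ 2 * pos a
  pos′-punchIn a = insertAt-punchIn _ v _ a

  pos′-injective : Injective _≡_ _≡_ pos′
  pos′-injective {u} {w} eq with punchView v u | punchView v w
  ... | at        | at        = refl
  ... | at        | punched b =
    contradiction (trans (≡.sym (pos′-punchIn b)) (trans (≡.sym eq) pos′-v)) (even≢odd (pos b) p)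
  ... | punched a | at        =
    contradiction (trans (≡.sym (pos′-punchIn a)) (trans eq pos′-v)) (even≢odd (pos a) p)
  ... | punched a | punched b =
    cong (punchIn v) (pos-injective (*-cancelˡ-≡ _ _ 2
      (trans (≡.sym (pos′-punchIn a)) (trans eq (pos′-punchIn b)))))

  data Chord (u w : Fin (suc n)) : Set where
    short : pos′ w ≡ suc (pos′ u) ⊎ pos′ u ≡ suc (pos′ w) → Chord u w
    old   : ∀ {a b} → E (punchIn v a) (punchIn v b) →
            pos′ u ≡ 2 * pos a → pos′ w ≡ 2 * pos b → Chord u w

  v-chord : ∀ a → E v (punchIn v a) ⊎ E (punchIn v a) v → pos′ v ≡ suc (pos′ (punchIn v a))
  v-chord a e = begin
    pos′ v                   ≡⟨ pos′-v ⟩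
    suc (2 * p)              ≡⟨ cong (λ q → suc (2 * q)) (neighbours-at-p a e) ⟨
    suc (2 * pos a)          ≡⟨ cong suc (pos′-punchIn a) ⟨
    suc (pos′ (punchIn v a)) ∎
    where open ≡.≡-Reasoning

  chord : ∀ {u w} → E u w → Chord u w
  chord {u} {w} e with punchView v u | punchView v w
  ... | at        | at        = contradiction e E-irrefl-v
  ... | at        | punched b = short (inj₂ (v-chord b (inj₁ e)))
  ... | punched a | at        = short (inj₁ (v-chord a (inj₂ e)))
  ... | punched a | punched b = old e (pos′-punchIn a) (pos′-punchIn b)

  pos′-noncrossing : NonCrossing E pos′
  pos′-noncrossing a b c d eab ecd (ac , cb , bd) with chord eab | chord ecd
  ... | short s          | _                = nothing-strictly-between-successors ac cb s
  ... | old _ _ _        | short s          = nothing-strictly-between-successors cb bd s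
  ... | old e₁ a≡ b≡ | old e₂ c≡ d≡ =
    noncrossing _ _ _ _ e₁ e₂ (halve-< a≡ c≡ ac , halve-< c≡ b≡ cb , halve-< b≡ d≡ bd)

  outerplanar : OuterplanarRel E
  outerplanar = pos′ , pos′-injective , pos′-noncrossing

Joined : ∀ {n} → (Fin n → Fin n → Set) → Fin n → Fin n → Set
Joined E u w = E u w × E w u

-- Two common neighbours of a and b on the same side of the chord ab give two crossing chords
-- through a and b, and of three common neighbours two lie on the same side.
module K₂,₃ {n} {E : Fin n → Fin n → Set} {pos : Fin n → ℕ}
  (pos-injective : Injective _≡_ _≡_ pos) (noncrossing : NonCrossing E pos)
  (E-irrefl : ∀ u → ¬ E u u) {a b : Fin n} (a<b : pos a < pos b) where

  Common : Fin n → Set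
  Common w = Joined E a w × Joined E b w

  Inside Outside : Fin n → Set
  Inside w  = pos a < pos w × pos w < pos b
  Outside w = pos w < pos a ⊎ pos b < pos w

  SameSide : Fin n → Fin n → Set
  SameSide p q = (Inside p × Inside q) ⊎ (Outside p × Outside q)

  sameSide-ordered-crossing : ∀ {p q} → Common p → Common q → pos p < pos q → ¬ SameSide p q
  sameSide-ordered-crossing {p} {q} ((ap , pa) , (bp , pb)) ((aq , qa) , (bq , qb)) p<q = λ where
    (inj₁ ((a<p , _) , (_ , q<b))) → noncrossing a q p b aq pb (a<p , p<q , q<b)
    (inj₂ (inj₁ p<a , inj₁ q<a))   → noncrossing p a q b pa qb (p<q , q<a , a<b)
    (inj₂ (inj₁ p<a , inj₂ b<q))   → noncrossing p b a q pb aq (p<a , a<b , b<q)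
    (inj₂ (inj₂ b<p , inj₁ q<a))   → <-asym p<q (<-trans q<a (<-trans a<b b<p))
    (inj₂ (inj₂ b<p , inj₂ b<q))   → noncrossing a p b q ap bq (a<b , b<p , p<q)

  SameSide-swap : ∀ {p q} → SameSide p q → SameSide q p
  SameSide-swap = Data.Sum.map Data.Product.swap Data.Product.swap

  sameSide-crossing : ∀ {p q} → Common p → Common q → p ≢ q → ¬ SameSide p q
  sameSide-crossing {p} {q} cp cq p≢q side with <-cmp (pos p) (pos q)
  ... | tri< p<q _ _ = sameSide-ordered-crossing cp cq p<q side
  ... | tri≈ _ eq _  = p≢q (pos-injective eq)
  ... | tri> _ _ q<p = sameSide-ordered-crossing cq cp q<p (SameSide-swap side)

  E⇒pos≢ : ∀ {u w} → E u w → pos w ≢ pos u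
  E⇒pos≢ {w = w} e eq with refl ← pos-injective eq = E-irrefl w e

  side : ∀ {w} → Common w → Inside w ⊎ Outside w
  side {w} ((aw , _) , (bw , _)) with <-cmp (pos w) (pos a) | <-cmp (pos w) (pos b)
  ... | tri< w<a _ _ | _            = inj₂ (inj₁ w<a)
  ... | tri≈ _ eq _  | _            = contradiction eq (E⇒pos≢ aw)
  ... | tri> _ _ a<w | tri< w<b _ _ = inj₁ (a<w , w<b)
  ... | tri> _ _ _   | tri≈ _ eq _  = contradiction eq (E⇒pos≢ bw)
  ... | tri> _ _ _   | tri> _ _ b<w = inj₂ (inj₂ b<w)

  three-common-crossing : ¬ Three Common
  three-common-crossing T = two-on-one-side (side Px) (side Py) (side Pz)
    where
    open Three T
    two-on-one-side : Inside x ⊎ Outside x → Inside y ⊎ Outside y → Inside z ⊎ Outside z → ⊥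
    two-on-one-side (inj₁ ix) (inj₁ iy) _         = sameSide-crossing Px Py x≢y (inj₁ (ix , iy))
    two-on-one-side (inj₂ ox) (inj₂ oy) _         = sameSide-crossing Px Py x≢y (inj₂ (ox , oy))
    two-on-one-side (inj₁ ix) (inj₂ _)  (inj₁ iz) = sameSide-crossing Px Pz x≢z (inj₁ (ix , iz))
    two-on-one-side (inj₁ _)  (inj₂ oy) (inj₂ oz) = sameSide-crossing Py Pz y≢z (inj₂ (oy , oz))
    two-on-one-side (inj₂ _)  (inj₁ iy) (inj₁ iz) = sameSide-crossing Py Pz y≢z (inj₁ (iy , iz))
    two-on-one-side (inj₂ ox) (inj₁ _)  (inj₂ oz) = sameSide-crossing Px Pz x≢z (inj₂ (ox , oz))

K₂,₃-not-outerplanar : ∀ {n} {E : Fin n → Fin n → Set} → OuterplanarRel E → (∀ u → ¬ E u u) →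
  ∀ {a b} → a ≢ b → ¬ Three (λ w → Joined E a w × Joined E b w)
K₂,₃-not-outerplanar (pos , pos-injective , noncrossing) E-irrefl {a} {b} a≢b T
  with <-cmp (pos a) (pos b)
... | tri< a<b _ _ = K₂,₃.three-common-crossing pos-injective noncrossing E-irrefl a<b T
... | tri≈ _ eq _  = a≢b (pos-injective eq)
... | tri> _ _ b<a = K₂,₃.three-common-crossing pos-injective noncrossing E-irrefl b<a
                       (Three-map id Data.Product.swap T)

-- Degenerate graphs

data Degenerate (k : ℕ) : (n : ℕ) → Graph n → Set where
  empty : (G : Graph 0) → Degenerate k 0 G
  peel  : ∀ {n m} (G : Graph (suc n)) (v : Fin (suc n)) → m ≤ k → (f : Fin m → Fin n) →
          (∀ a → Adj G v (punchIn v a) → ∃[ i ] f i ≡ a) →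
          Degenerate k n (deleteVertex G v) → Degenerate k (suc n) G

degenerate-≤suc : ∀ {k m} (G : Graph m) → m ≤ suc k → Degenerate k m G
degenerate-≤suc {m = zero}  G _         = empty G
degenerate-≤suc {m = suc m} G (s≤s m≤k) =
  peel G F.zero m≤k id (λ a _ → a , refl)
       (degenerate-≤suc (deleteVertex G F.zero) (m≤n⇒m≤1+n m≤k))

KTree⇒Degenerate : ∀ {j k n} {G : Graph n} → KTree j n G → j ≤ k → Degenerate k n G
KTree⇒Degenerate (base G _)                 j≤k = degenerate-≤suc G (s≤s j≤k)
KTree⇒Degenerate (step G v f _ covers _ _ T) j≤k = peel G v j≤k f covers (KTree⇒Degenerate T j≤k)

-- The edge from v to f i gets colour i, so every colour class meets v in at most one edge.
module PeelColouring {k n m} (G : Graph (suc n)) (v : Fin (suc n)) (m≤1+k : m ≤ suc k)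
  (f : Fin m → Fin n) (covers : ∀ a → Adj G v (punchIn v a) → ∃[ i ] f i ≡ a)
  (col′ : Fin n → Fin n → Fin (suc k)) where

  G′ : Graph n
  G′ = deleteVertex G v

  edgeColourFrom : ∀ {a} → Dec (∃[ i ] f i ≡ a) → Fin (suc k)
  edgeColourFrom (yes (i , _)) = inject≤ i m≤1+k
  edgeColourFrom (no _)        = F.zero

  edgeColour : Fin n → Fin (suc k)
  edgeColour a = edgeColourFrom (any? λ i → f i F.≟ a)

  row : Fin n → Fin (suc n) → Fin (suc k)
  row a = insertAt (col′ a) v (edgeColour a)

  row-v : Fin (suc n) → Fin (suc k)
  row-v = insertAt edgeColour v F.zero

  col : Fin (suc n) → Fin (suc n) → Fin (suc k)
  col = insertAt row v row-v

  col-punchIn : ∀ a b → col (punchIn v a) (punchIn v b) ≡ col′ a b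
  col-punchIn a b = trans (cong (λ r → r (punchIn v b)) (insertAt-punchIn row v row-v a))
                          (insertAt-punchIn (col′ a) v (edgeColour a) b)

  col-v : ∀ a → col v (punchIn v a) ≡ edgeColour a
  col-v a = trans (cong (λ r → r (punchIn v a)) (insertAt-lookup row v row-v))
                  (insertAt-punchIn edgeColour v F.zero a)

  col-v′ : ∀ a → col (punchIn v a) v ≡ edgeColour a
  col-v′ a = trans (cong (λ r → r v) (insertAt-punchIn row v row-v a))
                   (insertAt-lookup (col′ a) v (edgeColour a))

  col-sym : (∀ a b → Adj G′ a b → col′ a b ≡ col′ b a) →
            ∀ u w → Adj G u w → col u w ≡ col w u
  col-sym col′-sym u w e with punchView v u | punchView v w
  ... | at        | at        = refl
  ... | at        | punched b = trans (col-v b) (≡.sym (col-v′ b))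
  ... | punched a | at        = trans (col-v′ a) (≡.sym (col-v a))
  ... | punched a | punched b =
    trans (col-punchIn a b) (trans (col′-sym a b e) (≡.sym (col-punchIn b a)))

  module _ (c : Fin (suc k)) (pos : Fin n → ℕ) where

    -- the position of f j for the j of colour c, i.e. of v's only possible neighbour in class c
    anchorFrom : Dec (∃[ j ] inject≤ j m≤1+k ≡ c) → ℕ
    anchorFrom (yes (j , _)) = pos (f j)
    anchorFrom (no _)        = 0

    anchor : ℕ
    anchor = anchorFrom (any? λ j → inject≤ j m≤1+k F.≟ c)

    neighbour-at-anchorFrom : ∀ {a} (a? : Dec (∃[ i ] f i ≡ a))
                              (c? : Dec (∃[ j ] inject≤ j m≤1+k ≡ c)) →
                    ∃[ i ] f i ≡ a → edgeColourFrom a? ≡ c → pos a ≡ anchorFrom c?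
    neighbour-at-anchorFrom (no ¬fi≡a)       _              fi≡a _  = contradiction fi≡a ¬fi≡a
    neighbour-at-anchorFrom (yes (i , _))    (no ¬j)        _    eq = contradiction (i , eq) ¬j
    neighbour-at-anchorFrom (yes (i , refl)) (yes (j , eq′)) _   eq =
      cong (pos ∘ f) (inject≤-injective m≤1+k m≤1+k i j (trans eq (≡.sym eq′)))

    neighbour-at-anchor : ∀ a → Adj G v (punchIn v a) → edgeColour a ≡ c → pos a ≡ anchor
    neighbour-at-anchor a e =
      neighbour-at-anchorFrom (any? λ i → f i F.≟ a) (any? λ j → inject≤ j m≤1+k F.≟ c)
                              (covers a e)

  colourClass-outerplanar : ∀ c →
    OuterplanarRel (ColourClass G′ col′ c) → OuterplanarRel (ColourClass G col c)
  colourClass-outerplanar c (pos , pos-injective , noncrossing) =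
    InsertPendant.outerplanar v pos pos-injective
      (NonCrossing-mono (λ a b (e , eq) → e , trans (≡.sym (col-punchIn a b)) eq) noncrossing)
      (λ (e , _) → Adj-irrefl G v e)
      (anchor c pos) neighbour
    where
    neighbour : ∀ a → ColourClass G col c v (punchIn v a) ⊎ ColourClass G col c (punchIn v a) v →
                pos a ≡ anchor c pos
    neighbour a (inj₁ (e , eq)) = neighbour-at-anchor c pos a e (trans (≡.sym (col-v a)) eq)
    neighbour a (inj₂ (e , eq)) =
      neighbour-at-anchor c pos a (Adj-sym G e) (trans (≡.sym (col-v′ a)) eq)

Degenerate⇒OuterthicknessAtMost : ∀ {k n} {G : Graph n} →
  Degenerate (suc k) n G → OuterthicknessAtMost (suc k) G
Degenerate⇒OuterthicknessAtMost (empty G) = (λ ()) , (λ ()) , λ _ → (λ ()) , (λ { {()} }) , λ ()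
Degenerate⇒OuterthicknessAtMost (peel G v m≤1+k f covers D)
  with col′ , col′-sym , outerplanar′ ← Degenerate⇒OuterthicknessAtMost D =
  col , col-sym col′-sym , λ c → colourClass-outerplanar c (outerplanar′ c)
  where open PeelColouring G v m≤1+k f covers col′

TreewidthAtMost⇒OuterthicknessAtMost : ∀ {k n} (G : Graph n) →
  TreewidthAtMost (suc k) G → OuterthicknessAtMost (suc k) G
TreewidthAtMost⇒OuterthicknessAtMost G (j , j≤k , H , T , G⊆H) =
  OuterthicknessAtMost-spanningSubgraph {G = G} {H = H} G⊆H
    (Degenerate⇒OuterthicknessAtMost (KTree⇒Degenerate T j≤k))

-- A triple pigeonhole principle

bit : ∀ {P : Set} → Dec P → Fin 2
bit (yes _) = 1F
bit (no _)  = 0F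

bit-reflects : ∀ {P Q : Set} (p? : Dec P) (q? : Dec Q) → bit p? ≡ bit q? → Q → P
bit-reflects (yes p) _        _  _ = p
bit-reflects (no _)  (yes _)  () _
bit-reflects (no _)  (no ¬q)  _  q = contradiction q ¬q

module _ {M n} (f : Fin n → Fin M) where

  HasEarlier : Fin n → Set
  HasEarlier t = ∃[ s ] s F.< t × f s ≡ f t

  hasEarlier? : ∀ t → Dec (HasEarlier t)
  hasEarlier? t = any? λ s → (s F.<? t) ×-dec (f s F.≟ f t)

  -- Pigeonhole on (value, has an earlier element with the same value) gives i < j agreeing
  -- on both; j has the earlier i, hence i has some earlier s, and s < i < j share a value.
  triplePigeonhole : M * 2 < n → ∃[ β ] Three (λ t → f t ≡ β)
  triplePigeonhole M*2<n
    with i , j , i<j , codes≡ ← pigeonhole M*2<n (λ t → F.combine (f t) (bit (hasEarlier? t)))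
    with fi≡fj , bits≡ ← combine-injective (f i) _ (f j) _ codes≡
    with s , s<i , fs≡fi ← bit-reflects (hasEarlier? i) (hasEarlier? j) bits≡ (i , i<j , fi≡fj) =
    f i , record
      { x = s ; y = i ; z = j
      ; x≢y = Fin<⇒≢ s<i ; x≢z = Fin<⇒≢ (Fin<-trans s<i i<j) ; y≢z = Fin<⇒≢ i<j
      ; Px = fs≡fi ; Py = refl ; Pz = ≡.sym fi≡fj
      }

-- Complete split graphs

does⇒ : ∀ {A : Set} (a? : Dec A) → does a? ≡ true → A
does⇒ (yes a) _ = a

decGraph : ∀ {n} {R : Fin n → Fin n → Set} →
           Decidable R → Symmetric R → (∀ u → ¬ R u u) → Graph n
decGraph R? R-sym R-irrefl = record
  { adj    = λ u w → does (R? u w)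
  ; sym    = λ u w → does-⇔ (mk⇔ R-sym R-sym) (R? u w) (R? w u)
  ; irrefl = λ u → dec-false (R? u u) (R-irrefl u)
  }

Adj-decGraph : ∀ {n} {R : Fin n → Fin n → Set} (R? : Decidable R) (R-sym : Symmetric R)
               (R-irrefl : ∀ u → ¬ R u u) → ∀ u w → Adj (decGraph R? R-sym R-irrefl) u w ⇔ R u w
Adj-decGraph R? _ _ u w = mk⇔ (does⇒ (R? u w)) (dec-true (R? u w))

-- The vertices below k form a clique and are joined to everything: K_k + complement of K_(n-k).
CompleteSplit : ℕ → ∀ {n} → Fin n → Fin n → Set
CompleteSplit k u w = u ≢ w × (toℕ u < k ⊎ toℕ w < k)

IsCompleteSplit : ℕ → ∀ {n} → Graph n → Set
IsCompleteSplit k G = ∀ u w → Adj G u w ⇔ CompleteSplit k u w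

completeSplit? : ∀ k {n} → Decidable (CompleteSplit k {n})
completeSplit? k u w = ¬? (u F.≟ w) ×-dec (toℕ u <? k ⊎-dec toℕ w <? k)

completeSplit-sym : ∀ {k n} → Symmetric (CompleteSplit k {n})
completeSplit-sym (u≢w , below) = u≢w ∘ ≡.sym , Data.Sum.swap below

completeSplit-irrefl : ∀ {k n} (u : Fin n) → ¬ CompleteSplit k u u
completeSplit-irrefl u (u≢u , _) = u≢u refl

completeSplitGraph : ℕ → (n : ℕ) → Graph n
completeSplitGraph k n = decGraph (completeSplit? k) completeSplit-sym completeSplit-irrefl

completeSplitGraph-isCompleteSplit : ∀ k n → IsCompleteSplit k (completeSplitGraph k n)
completeSplitGraph-isCompleteSplit k n =
  Adj-decGraph (completeSplit? k) completeSplit-sym completeSplit-irrefl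

toℕ-punchIn-last : ∀ {n} (a : Fin n) → toℕ (punchIn (fromℕ n) a) ≡ toℕ a
toℕ-punchIn-last F.zero    = refl
toℕ-punchIn-last (F.suc a) = cong suc (toℕ-punchIn-last a)

completeSplit-complete : ∀ {k} {G : Graph (suc k)} → IsCompleteSplit k G → Complete G
completeSplit-complete {k} split u w u≢w = Equivalence.from (split u w) (u≢w , below)
  where
  below : toℕ u < k ⊎ toℕ w < k
  below with toℕ u <? k | toℕ w <? k
  ... | yes u<k | _       = inj₁ u<k
  ... | no _    | yes w<k = inj₂ w<k
  ... | no u≮k  | no w≮k  =
    contradiction (toℕ-injective (trans (at-k u u≮k) (≡.sym (at-k w w≮k)))) u≢w
    where
    at-k : ∀ x → ¬ toℕ x < k → toℕ x ≡ k
    at-k x x≮k = ≤-antisym (s≤s⁻¹ (toℕ<n x)) (≮⇒≥ x≮k)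

completeSplit-deleteLast : ∀ {k n} {G : Graph (suc n)} →
  IsCompleteSplit k G → IsCompleteSplit k (deleteVertex G (fromℕ n))
completeSplit-deleteLast {k} {n} split a b = mk⇔
  (λ e → let (pa≢pb , below) = Equivalence.to (split _ _) e in
         pa≢pb ∘ cong (punchIn (fromℕ n)) , Data.Sum.map (drop a) (drop b) below)
  (λ (a≢b , below) → Equivalence.from (split _ _)
         (a≢b ∘ punchIn-injective (fromℕ n) a b , Data.Sum.map (lift a) (lift b) below))
  where
  drop : ∀ x → toℕ (punchIn (fromℕ n) x) < k → toℕ x < k
  drop x = subst (_< k) (toℕ-punchIn-last x)
  lift : ∀ x → toℕ x < k → toℕ (punchIn (fromℕ n) x) < k
  lift x = subst (_< k) (≡.sym (toℕ-punchIn-last x))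

completeSplit-KTree : ∀ {k n} {G : Graph n} → k < n → IsCompleteSplit k G → KTree k n G
completeSplit-KTree {k} {suc n} {G} (s≤s k≤n) split with m≤n⇒m<n∨m≡n k≤n
... | inj₂ refl = base G (completeSplit-complete {G = G} split)
... | inj₁ k<n  =
  step G v f f-injective covers v-adjacent f-clique
       (completeSplit-KTree k<n (completeSplit-deleteLast {G = G} split))
  where
  v : Fin (suc n)
  v = fromℕ n

  f : Fin k → Fin n
  f i = inject≤ i k≤n

  f-injective : Injective _≡_ _≡_ f
  f-injective {i} {j} = inject≤-injective k≤n k≤n i j

  toℕ-f : ∀ i → toℕ (punchIn v (f i)) ≡ toℕ i
  toℕ-f i = trans (toℕ-punchIn-last (f i)) (toℕ-inject≤ i k≤n)

  f-below : ∀ i → toℕ (punchIn v (f i)) < k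
  f-below i = subst (_< k) (≡.sym (toℕ-f i)) (toℕ<n i)

  covers : ∀ a → Adj G v (punchIn v a) → ∃[ i ] f i ≡ a
  covers a e with Equivalence.to (split v (punchIn v a)) e
  ... | _ , inj₁ v<k = contradiction (subst (_< k) (toℕ-fromℕ n) v<k) (<⇒≱ k<n ∘ <⇒≤)
  ... | _ , inj₂ a<k = fromℕ< a<k′ , toℕ-injective (trans (toℕ-inject≤ _ k≤n) (toℕ-fromℕ< a<k′))
    where
    a<k′ : toℕ a < k
    a<k′ = subst (_< k) (toℕ-punchIn-last a) a<k

  v-adjacent : ∀ i → Adj G v (punchIn v (f i))
  v-adjacent i = Equivalence.from (split _ _) (punchInᵢ≢i v (f i) ∘ ≡.sym , inj₂ (f-below i))

  f-clique : ∀ i j → i ≢ j → Adj G (punchIn v (f i)) (punchIn v (f j))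
  f-clique i j i≢j = Equivalence.from (split _ _)
    (i≢j ∘ f-injective ∘ punchIn-injective v _ _ , inj₁ (f-below i))

module LowerBound (k′ : ℕ) where

  -- M counts the codes (i, j, γ) with i, j : Fin k and γ : Fin k′.
  k M m N : ℕ
  k = suc k′
  M = k * k * k′
  m = suc (M * 2)
  N = k + m

  G : Graph N
  G = completeSplitGraph k N

  clique : Fin k → Fin N
  clique i = i ↑ˡ m

  independent : Fin m → Fin N
  independent t = k ↑ʳ t

  clique-independent : ∀ i t → Adj G (clique i) (independent t)
  clique-independent i t = Equivalence.from (completeSplitGraph-isCompleteSplit k N _ _)
    (clique≢independent , inj₁ clique-below)
    where
    clique-below : toℕ (clique i) < k
    clique-below = subst (_< k) (≡.sym (toℕ-↑ˡ i m)) (toℕ<n i)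
    clique≢independent : clique i ≢ independent t
    clique≢independent eq = <⇒≱ clique-below
      (subst (k ≤_) (trans (≡.sym (toℕ-↑ʳ k t)) (cong toℕ (≡.sym eq))) (m≤m+n k (toℕ t)))

  treewidth≤k : TreewidthAtMost k G
  treewidth≤k = k , ≤-refl , G ,
    completeSplit-KTree (m<m+n k z<s) (completeSplitGraph-isCompleteSplit k N) , λ _ _ e → e

  module _ (col : Fin N → Fin N → Fin k′) (col-sym : ∀ u w → Adj G u w → col u w ≡ col w u)
           (outerplanar : ∀ γ → OuterplanarRel (ColourClass G col γ)) where

    colourTo : Fin m → Fin k → Fin k′
    colourTo t i = col (independent t) (clique i)

    repeated : ∀ t → ∃₂ λ i j → i F.< j × colourTo t i ≡ colourTo t j
    repeated t = pigeonhole (n<1+n k′) (colourTo t)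

    first second : Fin m → Fin k
    first t  = proj₁ (repeated t)
    second t = proj₁ (proj₂ (repeated t))

    first<second : ∀ t → first t F.< second t
    first<second t = proj₁ (proj₂ (proj₂ (repeated t)))

    first≡second : ∀ t → colourTo t (first t) ≡ colourTo t (second t)
    first≡second t = proj₂ (proj₂ (proj₂ (repeated t)))

    code : Fin m → Fin M
    code t = F.combine (F.combine (first t) (second t)) (colourTo t (first t))

    sameCode : ∀ {w t} → code w ≡ code t →
               colourTo w (first t) ≡ colourTo t (first t) ×
               colourTo w (second t) ≡ colourTo t (first t)
    sameCode {w} {t} eq
      with pair≡ , colour≡ ← combine-injective _ _ _ _ eq
      with first≡ , second≡ ← combine-injective _ _ _ _ pair≡ =
      trans (cong (colourTo w) (≡.sym first≡)) colour≡ ,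
      trans (cong (colourTo w) (≡.sym second≡)) (trans (≡.sym (first≡second w)) colour≡)

    joined : ∀ {t i γ} → colourTo t i ≡ γ →
             Joined (ColourClass G col γ) (clique i) (independent t)
    joined {t} {i} eq =
      (edge , trans (col-sym (clique i) (independent t) edge) eq) ,
      (Adj-sym G {clique i} {independent t} edge , eq)
      where
      edge : Adj G (clique i) (independent t)
      edge = clique-independent i t

    monochromatic-K₂,₃ : ∀ {β} → ¬ Three (λ t → code t ≡ β)
    monochromatic-K₂,₃ {β} T =
      K₂,₃-not-outerplanar {E = ColourClass G col γ} (outerplanar γ)
        (λ u (e , _) → Adj-irrefl G u e)
        (Fin<⇒≢ (first<second t₀) ∘ ↑ˡ-injective m _ _)
        (Three-map (↑ʳ-injective k _ _) common T)
      where
      t₀ : Fin m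
      t₀ = Three.x T
      γ : Fin k′
      γ = colourTo t₀ (first t₀)
      common : ∀ {t} → code t ≡ β →
               Joined (ColourClass G col γ) (clique (first t₀)) (independent t) ×
               Joined (ColourClass G col γ) (clique (second t₀)) (independent t)
      common eq with first-γ , second-γ ← sameCode (trans eq (≡.sym (Three.Px T))) =
        joined first-γ , joined second-γ

    no-colouring : ⊥
    no-colouring = monochromatic-K₂,₃ (proj₂ (triplePigeonhole code (n<1+n (M * 2))))

  outerthickness>k′ : ¬ OuterthicknessAtMost k′ G
  outerthickness>k′ (col , col-sym , outerplanar) = no-colouring col col-sym outerplanar

proposition3 : (k : ℕ) → 1 ≤ k →
    ((n : ℕ) (G : Graph n) → TreewidthAtMost k G → OuterthicknessAtMost k G)
    × Σ ℕ (λ n → Σ (Graph n) (λ G →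
        TreewidthAtMost k G × ¬ OuterthicknessAtMost (k ∸ 1) G))
proposition3 (suc k′) _ =
  (λ _ G → TreewidthAtMost⇒OuterthicknessAtMost G) , N , G , treewidth≤k , outerthickness>k′
  where open LowerBound k′
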